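{- Let $U_1=\{1,\dots,30\}$ and $U_2=\{31,\dots,60\}$, with pair partitions $\mathcal{P}_1=\{\{2i-1,2i\}:1\le i\le 15\}$ of $U_1$ and $\mathcal{P}_2=\{\{30+2i-1,30+2i\}:1\le i\le 15\}$ of $U_2$. For $t\in\{1,2\}$ let $\mathcal{B}_t=\{P\cup P'\cup P'':\ P,P',P''\in\mathcal{P}_t\text{ pairwise distinct}\}$. Then for every $6$-subset $S\subset[60]$ there exists $S'\in\mathcal{B}_1\cup\mathcal{B}_2$ with $|S\cap S'|\ge 3$. -}

module Defs where

open import Data.Nat using (ℕ; _+_; _*_)
open import Data.Nat.Properties using (_≟_)
open import Data.Fin using (Fin; toℕ)
open import Data.Fin.Subset using (Subset; _∪_)
open import Data.Vec using (tabulate)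
open import Relation.Nullary.Decidable using (⌊_⌋; _⊎-dec_)

-- The ground set [60] = {1,…,60} is represented by Fin 60:
-- the element x : Fin 60 stands for the number  toℕ x + 1.
num : Fin 60 → ℕ
num x = toℕ x + 1

-- Block t ∈ {1,2} is indexed by t' : Fin 2 (t = toℕ t' + 1);
-- pair index i ∈ {1,…,15} by i' : Fin 15 (i = toℕ i' + 1).
-- pair t i = {30(t-1)+2i-1, 30(t-1)+2i}
--          = {30 t' + 2 i' + 1, 30 t' + 2 i' + 2}.
pair : Fin 2 → Fin 15 → Subset 60
pair t i = tabulate λ x →
  ⌊ (num x ≟ 30 * toℕ t + 2 * toℕ i + 1) ⊎-dec (num x ≟ 30 * toℕ t + 2 * toℕ i + 2) ⌋

-- Union of three pairs of 𝒫_t  (an element of ℬ_t when i, j, k are pairwise distinct).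
triple : Fin 2 → Fin 15 → Fin 15 → Fin 15 → Subset 60
triple t i j k = pair t i ∪ pair t j ∪ pair t k

{-# OPTIONS --safe #-}
-- The thirty pairs cover [60], so the six points of S are distributed over them and
-- one block 𝒫_t contains at least three of them. For ℕ-valued weights on at least three
-- indices, some three distinct indices carry weight at least min(3, total): given such a
-- triple for all indices but the first, the first weight is 0, or it replaces a member
-- of weight 0, or else the first two members are positive and it completes them to
-- weight ≥ 3. Weighting the pairs of 𝒫_t by their number of points of S yields three
-- distinct pairs carrying at least three points; being disjoint, their union meets S in
-- at least three points.
module Submission where

open import Defs
open import Function using (_∘_)
open import Data.Nat using (ℕ; zero; suc; _+_; _⊓_; _≤_; _≤?_)
open import Data.Nat.Properties
  using ( +-suc; +-identityʳ; +-assoc; m≤m+n; +-monoʳ-≤; +-mono-≤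
        ; +-distribˡ-⊓; ⊓-monoˡ-≤; m⊓n≤m; m⊓n≤n; m≤n⇒m⊓n≡m; ≤-trans; ≤-reflexive
        ; m≤n+m; +-monoˡ-<; +-cancelˡ-<; ≤-<-trans; <⇒≤; n≢0⇒n>0; ≰⇒>; module ≤-Reasoning)
  renaming (_≟_ to _≟ℕ_)
open import Data.Nat.ListAction using (sum)
open import Data.Fin using (Fin; zero; suc)
open import Data.Fin.Properties using (all?; suc-injective; _≟_)
open import Data.Fin.Subset using (Subset; _∩_; _∪_; ∣_∣; ⊥; ⊤; ⋃; inside; outside)
open import Data.Fin.Subset.Properties
  using (∩-distribˡ-∪; ∩-zeroʳ; ∩-identityʳ; ∪-identityʳ; ∣⊥∣≡0)
open import Data.Bool.Properties using () renaming (_≟_ to _≟ᵇ_)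
open import Data.List using (List; []; _∷_; map; tabulate)
open import Data.List.Properties using (map-tabulate)
open import Data.Vec using ([]; _∷_)
open import Data.Vec.Properties using (≡-dec)
open import Data.Product using (_×_; _,_; ∃-syntax)
open import Data.Sum using (_⊎_; inj₁; inj₂)
open import Relation.Nullary using (Dec; yes; no)
open import Relation.Nullary.Decidable using (from-yes; ¬?; _→-dec_)
open import Relation.Binary.PropositionalEquality
  using (_≡_; _≢_; refl; sym; trans; cong; cong₂; subst; module ≡-Reasoning)

∣s∩[p∪q]∣+∣s∩[p∩q]∣≡∣s∩p∣+∣s∩q∣ : ∀ {n} (s p q : Subset n) →
  ∣ s ∩ (p ∪ q) ∣ + ∣ s ∩ (p ∩ q) ∣ ≡ ∣ s ∩ p ∣ + ∣ s ∩ q ∣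
∣s∩[p∪q]∣+∣s∩[p∩q]∣≡∣s∩p∣+∣s∩q∣ [] [] [] = refl
∣s∩[p∪q]∣+∣s∩[p∩q]∣≡∣s∩p∣+∣s∩q∣ (outside ∷ s) (_ ∷ p) (_ ∷ q) =
  ∣s∩[p∪q]∣+∣s∩[p∩q]∣≡∣s∩p∣+∣s∩q∣ s p q
∣s∩[p∪q]∣+∣s∩[p∩q]∣≡∣s∩p∣+∣s∩q∣ (inside ∷ s) (outside ∷ p) (outside ∷ q) =
  ∣s∩[p∪q]∣+∣s∩[p∩q]∣≡∣s∩p∣+∣s∩q∣ s p q
∣s∩[p∪q]∣+∣s∩[p∩q]∣≡∣s∩p∣+∣s∩q∣ (inside ∷ s) (inside ∷ p) (outside ∷ q) =
  cong suc (∣s∩[p∪q]∣+∣s∩[p∩q]∣≡∣s∩p∣+∣s∩q∣ s p q)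
∣s∩[p∪q]∣+∣s∩[p∩q]∣≡∣s∩p∣+∣s∩q∣ (inside ∷ s) (outside ∷ p) (inside ∷ q) =
  trans (cong suc (∣s∩[p∪q]∣+∣s∩[p∩q]∣≡∣s∩p∣+∣s∩q∣ s p q)) (sym (+-suc _ _))
∣s∩[p∪q]∣+∣s∩[p∩q]∣≡∣s∩p∣+∣s∩q∣ (inside ∷ s) (inside ∷ p) (inside ∷ q) =
  cong suc (trans (+-suc _ _)
    (trans (cong suc (∣s∩[p∪q]∣+∣s∩[p∩q]∣≡∣s∩p∣+∣s∩q∣ s p q)) (sym (+-suc _ _))))

∣s∩[p∪q]∣≤∣s∩p∣+∣s∩q∣ : ∀ {n} (s p q : Subset n) → ∣ s ∩ (p ∪ q) ∣ ≤ ∣ s ∩ p ∣ + ∣ s ∩ q ∣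
∣s∩[p∪q]∣≤∣s∩p∣+∣s∩q∣ s p q =
  ≤-trans (m≤m+n _ _) (≤-reflexive (∣s∩[p∪q]∣+∣s∩[p∩q]∣≡∣s∩p∣+∣s∩q∣ s p q))

∣s∩⊥∣≡0 : ∀ {n} (s : Subset n) → ∣ s ∩ ⊥ ∣ ≡ 0
∣s∩⊥∣≡0 {n} s = trans (cong ∣_∣ (∩-zeroʳ s)) (∣⊥∣≡0 n)

p∩q≡⊥⇒∣s∩[p∪q]∣≡∣s∩p∣+∣s∩q∣ : ∀ {n} (s p q : Subset n) → p ∩ q ≡ ⊥ →
  ∣ s ∩ (p ∪ q) ∣ ≡ ∣ s ∩ p ∣ + ∣ s ∩ q ∣
p∩q≡⊥⇒∣s∩[p∪q]∣≡∣s∩p∣+∣s∩q∣ s p q p∩q≡⊥ = begin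
  ∣ s ∩ (p ∪ q) ∣                       ≡⟨ sym (+-identityʳ _) ⟩
  ∣ s ∩ (p ∪ q) ∣ + 0                   ≡⟨ cong (∣ s ∩ (p ∪ q) ∣ +_) (sym (∣s∩⊥∣≡0 s)) ⟩
  ∣ s ∩ (p ∪ q) ∣ + ∣ s ∩ ⊥ ∣            ≡⟨ cong (λ r → ∣ s ∩ (p ∪ q) ∣ + ∣ s ∩ r ∣) (sym p∩q≡⊥) ⟩
  ∣ s ∩ (p ∪ q) ∣ + ∣ s ∩ (p ∩ q) ∣      ≡⟨ ∣s∩[p∪q]∣+∣s∩[p∩q]∣≡∣s∩p∣+∣s∩q∣ s p q ⟩
  ∣ s ∩ p ∣ + ∣ s ∩ q ∣                 ∎
  where open ≡-Reasoning

∣s∩[p∪q∪r]∣≡∣s∩p∣+∣s∩q∣+∣s∩r∣ : ∀ {n} (s p q r : Subset n) →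
  p ∩ q ≡ ⊥ → q ∩ r ≡ ⊥ → p ∩ r ≡ ⊥ →
  ∣ s ∩ (p ∪ q ∪ r) ∣ ≡ ∣ s ∩ p ∣ + ∣ s ∩ q ∣ + ∣ s ∩ r ∣
∣s∩[p∪q∪r]∣≡∣s∩p∣+∣s∩q∣+∣s∩r∣ s p q r p∩q≡⊥ q∩r≡⊥ p∩r≡⊥ = begin
  ∣ s ∩ (p ∪ q ∪ r) ∣               ≡⟨ p∩q≡⊥⇒∣s∩[p∪q]∣≡∣s∩p∣+∣s∩q∣ s p (q ∪ r) p∩[q∪r]≡⊥ ⟩
  ∣ s ∩ p ∣ + ∣ s ∩ (q ∪ r) ∣        ≡⟨ cong (∣ s ∩ p ∣ +_) (p∩q≡⊥⇒∣s∩[p∪q]∣≡∣s∩p∣+∣s∩q∣ s q r q∩r≡⊥) ⟩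
  ∣ s ∩ p ∣ + (∣ s ∩ q ∣ + ∣ s ∩ r ∣) ≡⟨ sym (+-assoc (∣ s ∩ p ∣) (∣ s ∩ q ∣) (∣ s ∩ r ∣)) ⟩
  ∣ s ∩ p ∣ + ∣ s ∩ q ∣ + ∣ s ∩ r ∣   ∎
  where
  open ≡-Reasoning
  p∩[q∪r]≡⊥ : p ∩ (q ∪ r) ≡ ⊥
  p∩[q∪r]≡⊥ = trans (∩-distribˡ-∪ p q r) (trans (cong₂ _∪_ p∩q≡⊥ p∩r≡⊥) (∪-identityʳ ⊥))

∣s∩⋃ps∣≤sum[∣s∩p∣] : ∀ {n} (s : Subset n) (ps : List (Subset n)) →
  ∣ s ∩ ⋃ ps ∣ ≤ sum (map (λ p → ∣ s ∩ p ∣) ps)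
∣s∩⋃ps∣≤sum[∣s∩p∣] s []       = ≤-reflexive (∣s∩⊥∣≡0 s)
∣s∩⋃ps∣≤sum[∣s∩p∣] s (p ∷ ps) =
  ≤-trans (∣s∩[p∪q]∣≤∣s∩p∣+∣s∩q∣ s p (⋃ ps)) (+-monoʳ-≤ ∣ s ∩ p ∣ (∣s∩⋃ps∣≤sum[∣s∩p∣] s ps))

Distinct₃ : ∀ {n} → Fin n → Fin n → Fin n → Set
Distinct₃ i j k = i ≢ j × j ≢ k × i ≢ k

3⊓[m+n]≤m+3⊓n : ∀ m n → 3 ⊓ (m + n) ≤ m + 3 ⊓ n
3⊓[m+n]≤m+3⊓n m n = begin
  3 ⊓ (m + n)       ≤⟨ ⊓-monoˡ-≤ (m + n) (m≤n+m 3 m) ⟩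
  (m + 3) ⊓ (m + n) ≡⟨ sym (+-distribˡ-⊓ m 3 n) ⟩
  m + 3 ⊓ n         ∎
  where open ≤-Reasoning

HeavyTriple : ∀ {n} → (Fin n → ℕ) → Set
HeavyTriple c = ∃[ i ] ∃[ j ] ∃[ k ] (Distinct₃ i j k × 3 ⊓ sum (tabulate c) ≤ c i + c j + c k)

three-heaviest : ∀ {n} (c : Fin (3 + n) → ℕ) → HeavyTriple c
three-heaviest {zero} c =
  zero , suc zero , suc (suc zero) , ((λ ()) , (λ ()) , (λ ())) ,
  ≤-trans (m⊓n≤n 3 _) (≤-reflexive (begin
    c zero + (c (suc zero) + (c (suc (suc zero)) + 0)) ≡⟨ cong (λ x → c zero + (c (suc zero) + x)) (+-identityʳ _) ⟩
    c zero + (c (suc zero) + c (suc (suc zero)))       ≡⟨ sym (+-assoc (c zero) _ _) ⟩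
    c zero + c (suc zero) + c (suc (suc zero))         ∎))
  where open ≡-Reasoning
three-heaviest {suc n} c with three-heaviest (c ∘ suc)
... | i , j , k , (i≢j , j≢k , i≢k) , tail-bound =
  extend (c zero ≟ℕ 0) (c (suc i) ≟ℕ 0) (c (suc j) ≟ℕ 0)
  where
  open ≡-Reasoning
  T = sum (tabulate (c ∘ suc))
  s = c (suc i) + c (suc j) + c (suc k)

  bound : 3 ⊓ (c zero + T) ≤ c zero + s
  bound = ≤-trans (3⊓[m+n]≤m+3⊓n (c zero) T) (+-monoʳ-≤ (c zero) tail-bound)

  s≢s : ∀ {m} {x y : Fin m} → x ≢ y → suc x ≢ suc y
  s≢s x≢y = x≢y ∘ suc-injective

  extend : Dec (c zero ≡ 0) → Dec (c (suc i) ≡ 0) → Dec (c (suc j) ≡ 0) → HeavyTriple c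
  extend (yes a≡0) _ _ = suc i , suc j , suc k , (s≢s i≢j , s≢s j≢k , s≢s i≢k) ,
    subst (3 ⊓ (c zero + T) ≤_) (cong (_+ s) a≡0) bound
  extend (no _) (yes b≡0) _ = zero , suc j , suc k , ((λ ()) , s≢s j≢k , (λ ())) ,
    subst (3 ⊓ (c zero + T) ≤_) (begin
      c zero + (c (suc i) + c (suc j) + c (suc k)) ≡⟨ cong (λ b → c zero + (b + c (suc j) + c (suc k))) b≡0 ⟩
      c zero + (c (suc j) + c (suc k))             ≡⟨ sym (+-assoc (c zero) _ _) ⟩
      c zero + c (suc j) + c (suc k)               ∎) bound
  extend (no _) (no _) (yes d≡0) = zero , suc i , suc k , ((λ ()) , s≢s i≢k , (λ ())) ,
    subst (3 ⊓ (c zero + T) ≤_) (begin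
      c zero + (c (suc i) + c (suc j) + c (suc k)) ≡⟨ cong (λ d → c zero + (c (suc i) + d + c (suc k))) d≡0 ⟩
      c zero + (c (suc i) + 0 + c (suc k))         ≡⟨ cong (λ x → c zero + (x + c (suc k))) (+-identityʳ _) ⟩
      c zero + (c (suc i) + c (suc k))             ≡⟨ sym (+-assoc (c zero) _ _) ⟩
      c zero + c (suc i) + c (suc k)               ∎) bound
  extend (no a≢0) (no b≢0) (no d≢0) = suc i , suc j , zero , (s≢s i≢j , (λ ()) , (λ ())) ,
    ≤-trans (m⊓n≤m 3 _) (+-mono-≤ (+-mono-≤ (n≢0⇒n>0 b≢0) (n≢0⇒n>0 d≢0)) (n≢0⇒n>0 a≢0))

k+k≤m+n⇒k≤m⊎k≤n : ∀ k m n → k + k ≤ m + n → k ≤ m ⊎ k ≤ n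
k+k≤m+n⇒k≤m⊎k≤n k m n k+k≤m+n with k ≤? m
... | yes k≤m = inj₁ k≤m
... | no k≰m  = inj₂ (<⇒≤ (+-cancelˡ-< k k n (≤-<-trans k+k≤m+n (+-monoˡ-< n (≰⇒> k≰m)))))

-- i and j are explicit: recovering them from  pair t i  would normalise whole vectors.
pair-disjoint : ∀ t i j → i ≢ j → pair t i ∩ pair t j ≡ ⊥
pair-disjoint t i j = from-yes
  (all? λ t → all? λ i → all? λ j → ¬? (i ≟ j) →-dec ≡-dec _≟ᵇ_ (pair t i ∩ pair t j) ⊥) t i j

∣s∩triple∣≡sum : ∀ (s : Subset 60) t i j k → Distinct₃ i j k →
  ∣ s ∩ triple t i j k ∣ ≡ ∣ s ∩ pair t i ∣ + ∣ s ∩ pair t j ∣ + ∣ s ∩ pair t k ∣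
∣s∩triple∣≡sum s t i j k (i≢j , j≢k , i≢k) =
  ∣s∩[p∪q∪r]∣≡∣s∩p∣+∣s∩q∣+∣s∩r∣ s (pair t i) (pair t j) (pair t k)
  (pair-disjoint t i j i≢j) (pair-disjoint t j k j≢k) (pair-disjoint t i k i≢k)

block : Fin 2 → Subset 60
block t = ⋃ (tabulate (pair t))

block₁∪block₂≡⊤ : block zero ∪ block (suc zero) ≡ ⊤
block₁∪block₂≡⊤ = refl

hits : Subset 60 → Fin 2 → Fin 15 → ℕ
hits s t i = ∣ s ∩ pair t i ∣

∣s∩block∣≤sum[hits] : ∀ s t → ∣ s ∩ block t ∣ ≤ sum (tabulate (hits s t))
∣s∩block∣≤sum[hits] s t = ≤-trans (∣s∩⋃ps∣≤sum[∣s∩p∣] s (tabulate (pair t)))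
  (≤-reflexive (cong sum (map-tabulate (pair t) (λ p → ∣ s ∩ p ∣))))

∣s∣≤sum[hits₁]+sum[hits₂] : ∀ s →
  ∣ s ∣ ≤ sum (tabulate (hits s zero)) + sum (tabulate (hits s (suc zero)))
∣s∣≤sum[hits₁]+sum[hits₂] s = begin
  ∣ s ∣                                             ≡⟨ cong ∣_∣ (sym (∩-identityʳ s)) ⟩
  ∣ s ∩ ⊤ ∣                                         ≡⟨ cong (λ u → ∣ s ∩ u ∣) (sym block₁∪block₂≡⊤) ⟩
  ∣ s ∩ (block zero ∪ block (suc zero)) ∣           ≤⟨ ∣s∩[p∪q]∣≤∣s∩p∣+∣s∩q∣ s (block zero) (block (suc zero)) ⟩
  ∣ s ∩ block zero ∣ + ∣ s ∩ block (suc zero) ∣     ≤⟨ +-mono-≤ (∣s∩block∣≤sum[hits] s zero) (∣s∩block∣≤sum[hits] s (suc zero)) ⟩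
  sum (tabulate (hits s zero)) + sum (tabulate (hits s (suc zero))) ∎
  where open ≤-Reasoning

∣s∣≡6⇒∃block-hit-thrice : ∀ s → ∣ s ∣ ≡ 6 → ∃[ t ] 3 ≤ sum (tabulate (hits s t))
∣s∣≡6⇒∃block-hit-thrice s ∣s∣≡6 = select (k+k≤m+n⇒k≤m⊎k≤n 3 (total zero) (total (suc zero)) 6≤total)
  where
  total : Fin 2 → ℕ
  total t = sum (tabulate (hits s t))

  6≤total : 6 ≤ total zero + total (suc zero)
  6≤total = subst (_≤ total zero + total (suc zero)) ∣s∣≡6 (∣s∣≤sum[hits₁]+sum[hits₂] s)

  select : 3 ≤ total zero ⊎ 3 ≤ total (suc zero) → ∃[ t ] 3 ≤ total t
  select (inj₁ 3≤total₁) = zero , 3≤total₁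
  select (inj₂ 3≤total₂) = suc zero , 3≤total₂

heavy-block⇒heavy-triple : ∀ s t → 3 ≤ sum (tabulate (hits s t)) →
  ∃[ i ] ∃[ j ] ∃[ k ] (Distinct₃ i j k × 3 ≤ ∣ s ∩ triple t i j k ∣)
heavy-block⇒heavy-triple s t 3≤total = from-heaviest (three-heaviest (hits s t))
  where
  from-heaviest : HeavyTriple (hits s t) →
    ∃[ i ] ∃[ j ] ∃[ k ] (Distinct₃ i j k × 3 ≤ ∣ s ∩ triple t i j k ∣)
  from-heaviest (i , j , k , distinct , heavy) = i , j , k , distinct , (begin
    3                                    ≡⟨ sym (m≤n⇒m⊓n≡m 3≤total) ⟩
    3 ⊓ sum (tabulate (hits s t))        ≤⟨ heavy ⟩
    hits s t i + hits s t j + hits s t k ≡⟨ sym (∣s∩triple∣≡sum s t i j k distinct) ⟩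
    ∣ s ∩ triple t i j k ∣               ∎)
    where open ≤-Reasoning

proposition2 : (S : Subset 60) → ∣ S ∣ ≡ 6 →
    ∃[ t ] ∃[ i ] ∃[ j ] ∃[ k ]
      ((i ≢ j) × (j ≢ k) × (i ≢ k) × (3 ≤ ∣ S ∩ triple t i j k ∣))
proposition2 S ∣S∣≡6 =
  let t , 3≤total = ∣s∣≡6⇒∃block-hit-thrice S ∣S∣≡6
      i , j , k , (i≢j , j≢k , i≢k) , 3≤∣S∩triple∣ = heavy-block⇒heavy-triple S t 3≤total
  in t , i , j , k , i≢j , j≢k , i≢k , 3≤∣S∩triple∣
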